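{- For every positive integer $n$ with $n\not\equiv 1\pmod 3$, $$2t(1,1,27;n)=r\big(x^2+y^2+27z^2,\,4(8n+29)\big)-r\big(x^2+y^2+27z^2,\,8n+29\big).$$
   Context: For positive integers $a,b,c$ and an integer $n$, $t(a,b,c;n)$ denotes the number of $(x,y,z)\in\mathbb Z^3$ with $a\frac{x(x-1)}2+b\frac{y(y-1)}2+c\frac{z(z-1)}2=n$. For a quadratic form $h$ and integer $m$, $r(h,m)$ denotes the number of integer vectors $v$ with $h(v)=m$. -}

module Defs where

open import Data.Nat using (ℕ; suc)
open import Data.Integer using (ℤ; +_; -_; _+_; _*_; _-_)
open import Data.Integer using () renaming (_≟_ to _≟ℤ_)
open import Data.List using (List; map; filter; length; cartesianProduct; upTo)
open import Data.Product using (_×_; _,_)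

window : ℕ → List ℤ
window B = map (λ k → (+ k) - (+ B)) (upTo (suc (B Data.Nat.+ B)))

box : ℕ → List (ℤ × ℤ × ℤ)
box B = cartesianProduct (window B) (cartesianProduct (window B) (window B))

countIn : ℕ → (ℤ → ℤ → ℤ → ℤ) → ℤ → ℕ
countIn B f m = length (filter (λ { (x , y , z) → f x y z ≟ℤ m }) (box B))

tri2 : ℤ → ℤ
tri2 x = x * (x - + 1)

-- Every solution satisfies x(x-1)/2 ≤ n hence |x| ≤ n + 1 (a,b,c ≥ 1),
-- so counting in the box [-(n+1), n+1]^3 counts all solutions.
-- We multiply the equation by 2 to avoid division.
t : ℕ → ℕ → ℕ → ℕ → ℕ
t a b c n = countIn (suc n)
  (λ x y z → (+ a) * tri2 x + (+ b) * tri2 y + (+ c) * tri2 z) (+ (2 Data.Nat.* n))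

-- r(x² + y² + 27 z², m) = #{(x,y,z) ∈ ℤ³ : x² + y² + 27 z² = m}  (m ≥ 0).
-- Every solution has |x|,|y|,|z| ≤ m, so the box [-m, m]^3 contains all solutions.
r-x²+y²+27z² : ℕ → ℕ
r-x²+y²+27z² m = countIn m (λ x y z → x * x + y * y + (+ 27) * (z * z)) (+ m)

{-# OPTIONS --safe #-}
module Submission where

-- With a = 2x - 1, b = 2y - 1, c = 2z - 1, t(1,1,27;n) counts the odd solutions of
-- a² + b² + 27c² = m, m = 8n + 29.  Modulo 4, a solution of U² + V² + 27W² = 4m has U, V, W
-- all even (halving gives the r(m) solutions for m), or W odd and exactly one of U, V odd; swapping
-- U and V shows that both kinds are equally many.  So it suffices to match the odd solutions for m
-- with the solutions for 4m having U odd.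
--
-- The rational map M(a,b,c) = ((3a + 2b + 9c)/2, a - 9c, (a - 2b + 3c)/6) multiplies the form by 4
-- and M² = 4.  On the "normal" triples, a ≡ c (mod 4) and 3 ∣ a + b, it is an integral bijection onto
-- the normal solutions (U ≡ W (mod 4), 3 ∣ U + V) on the other side, with inverse M/4.  Every solution
-- is made normal by changing the signs of the second and third coordinates (on the left, in the
-- coordinates x, y, z, these are the reflections y ↦ 1 - y and z ↦ 1 - z); this is possible because
-- a² ≢ b² (mod 3) would force m ≡ 1, i.e. n ≡ 1 (mod 3), and similarly for U, V.  The bijection
-- normalises, applies M and restores the signs.  It is invertible because for a normal p and any sign
-- change h, the sign change normalising h·p is the one normalising h·M(p).

open import Defs using (window; box; countIn; tri2; t; r-x²+y²+27z²)

-- The development is kept in an anonymous module so that its integer operators are not in scope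
-- in the statement below, which uses those of ℕ.
module _ where

  open import Data.Bool using (Bool; true; false)
  open import Data.Fin using (Fin; zero; suc; toℕ; fromℕ<)
  open import Data.Fin.Properties using (toℕ-fromℕ<)
  open import Data.Integer as ℤ using (ℤ; +_; -[1+_]; _+_; _-_; -_; _*_; 0ℤ; 1ℤ; _/ℕ_; _%ℕ_; _≟_)
  open import Data.Integer.DivMod using (a≡a%ℕn+[a/ℕn]*n; n%ℕd<d)
  open import Data.Integer.Divisibility.Signed
  import Data.Integer.Properties as ℤ
  open import Data.Integer.Tactic.RingSolver using (solve-∀)
  open import Data.List using (List; []; _∷_; _++_; length; filter)
  open import Data.List.Membership.Propositional using (_∈_)
  open import Data.List.Membership.Propositional.Properties
    using (∈-∃++; ∈-++⁻; ∈-++⁺ˡ; ∈-++⁺ʳ; ∈-filter⁺; ∈-filter⁻; ∈-map⁺; ∈-upTo⁺; ∈-cartesianProduct⁺)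
  open import Data.List.Properties using (length-++-sucʳ)
  import Data.List.Relation.Unary.All as All
  open import Data.List.Relation.Unary.AllPairs using (_∷_)
  open import Data.List.Relation.Unary.Any using (here; there)
  open import Data.List.Relation.Unary.Unique.Propositional using (Unique)
  import Data.List.Relation.Unary.Unique.Propositional.Properties as Unique
  open import Data.Nat as ℕ using (ℕ; zero; suc; _≤_; z≤n; s≤s)
  import Data.Nat.Divisibility as ℕ
  open import Data.Nat.DivMod using ([m+kn]%n≡m%n)
  open import Data.Nat.Primality using (Prime; euclidsLemma; prime?)
  import Data.Nat.Properties as ℕ
  open import Data.Product using (_×_; _,_; ∃; proj₁; proj₂)
  open import Data.Sum as Sum using (_⊎_; inj₁; inj₂; fromInj₂)
  open import Function using (_∘_; _⇔_; mk⇔; Equivalence)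
  open import Level using (0ℓ)
  open import Relation.Binary.PropositionalEquality
  open import Relation.Nullary using (¬_; Dec; does; yes; no; contradiction)
  open import Relation.Nullary.Decidable using (dec-true; dec-false; does-⇔; from-yes; from-no)
  open import Relation.Unary using (Pred; Decidable)
  open import Relation.Unary.Properties using (∁?)

  -- Decisions and finite lists

  does-elim : ∀ {P : Set} (P? : Dec P) (C : Bool → Set) → (P → C true) → (¬ P → C false) → C (does P?)
  does-elim (yes p) C yes-case no-case = yes-case p
  does-elim (no ¬p) C yes-case no-case = no-case ¬p

  filter-cong : ∀ {A : Set} {P Q : Pred A 0ℓ} (P? : Decidable P) (Q? : Decidable Q) →
    (∀ x → does (P? x) ≡ does (Q? x)) → ∀ xs → filter P? xs ≡ filter Q? xs
  filter-cong P? Q? P?≗Q? [] = refl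
  filter-cong P? Q? P?≗Q? (x ∷ xs) with does (P? x) | does (Q? x) | P?≗Q? x
  ... | true  | true  | _ = cong (x ∷_) (filter-cong P? Q? P?≗Q? xs)
  ... | false | false | _ = filter-cong P? Q? P?≗Q? xs

  length-filter-∁ : ∀ {A : Set} {P : Pred A 0ℓ} (P? : Decidable P) (xs : List A) →
    length xs ≡ length (filter P? xs) ℕ.+ length (filter (∁? P?) xs)
  length-filter-∁ P? [] = refl
  length-filter-∁ P? (x ∷ xs) with P? x
  ... | yes _ = cong suc (length-filter-∁ P? xs)
  ... | no _  = trans (cong suc (length-filter-∁ P? xs)) (sym (ℕ.+-suc _ _))

  length-≤-injection : ∀ {A B : Set} (xs : List A) (ys : List B) (f : A → B) → Unique xs →
    (∀ {x} → x ∈ xs → f x ∈ ys) →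
    (∀ {x x′} → x ∈ xs → x′ ∈ xs → f x ≡ f x′ → x ≡ x′) →
    length xs ≤ length ys
  length-≤-injection [] ys f _ _ _ = z≤n
  length-≤-injection (x ∷ xs) ys f (x∉xs ∷ xs!) maps inj
    with ys₁ , ys₂ , refl ← ∈-∃++ (maps (here refl)) =
    ℕ.≤-trans (s≤s (length-≤-injection xs (ys₁ ++ ys₂) f xs! maps′ (λ p q → inj (there p) (there q))))
              (ℕ.≤-reflexive (sym (length-++-sucʳ ys₁ (f x) ys₂)))
    where
    maps′ : ∀ {x′} → x′ ∈ xs → f x′ ∈ ys₁ ++ ys₂
    maps′ {x′} x′∈xs with ∈-++⁻ ys₁ (maps (there x′∈xs))
    ... | inj₁ p = ∈-++⁺ˡ p
    ... | inj₂ (there p) = ∈-++⁺ʳ ys₁ p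
    ... | inj₂ (here fx′≡fx) =
      contradiction (inj (there x′∈xs) (here refl) fx′≡fx) (All.lookup x∉xs x′∈xs ∘ sym)

  length-≡-bijection : ∀ {A B : Set} (xs : List A) (ys : List B) (f : A → B) (g : B → A) →
    Unique xs → Unique ys →
    (∀ {x} → x ∈ xs → f x ∈ ys) → (∀ {y} → y ∈ ys → g y ∈ xs) →
    (∀ {x} → x ∈ xs → g (f x) ≡ x) → (∀ {y} → y ∈ ys → f (g y) ≡ y) →
    length xs ≡ length ys
  length-≡-bijection xs ys f g xs! ys! f-maps g-maps g∘f f∘g = ℕ.≤-antisym
    (length-≤-injection xs ys f xs! f-maps (λ p q e → trans (sym (g∘f p)) (trans (cong g e) (g∘f q))))
    (length-≤-injection ys xs g ys! g-maps (λ p q e → trans (sym (f∘g p)) (trans (cong f e) (f∘g q))))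

  -- Integer division and divisibility

  /ℕ-exact : ∀ d .{{_ : ℕ.NonZero d}} q → (q * + d) /ℕ d ≡ q
  /ℕ-exact d q = ℤ.*-cancelʳ-≡ (a /ℕ d) q (+ d) (begin
    a /ℕ d * + d                ≡⟨ ℤ.+-identityˡ _ ⟨
    + 0 + a /ℕ d * + d          ≡⟨ cong (λ r → + r + a /ℕ d * + d) r≡0 ⟨
    + (a %ℕ d) + a /ℕ d * + d   ≡⟨ a≡a%ℕn+[a/ℕn]*n a d ⟨
    q * + d                     ∎)
    where
    open ≡-Reasoning
    a : ℤ
    a = q * + d
    small-multiple≡0 : ∀ {r} → r ℕ.< d → + d ∣ + r → r ≡ 0
    small-multiple≡0 {zero} _ _ = refl
    small-multiple≡0 {suc r} r<d d∣r = contradiction (ℕ.∣⇒≤ (∣⇒∣ᵤ d∣r)) (ℕ.<⇒≱ r<d)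
    r≡0 : a %ℕ d ≡ 0
    r≡0 = small-multiple≡0 (n%ℕd<d a d) (divides (q - a /ℕ d) (begin
      + (a %ℕ d)                                   ≡⟨ restore (+ (a %ℕ d)) (a /ℕ d) (+ d) ⟩
      (+ (a %ℕ d) + a /ℕ d * + d) - a /ℕ d * + d   ≡⟨ cong (_- a /ℕ d * + d) (a≡a%ℕn+[a/ℕn]*n a d) ⟨
      q * + d - a /ℕ d * + d                       ≡⟨ factor q (a /ℕ d) (+ d) ⟩
      (q - a /ℕ d) * + d                           ∎))
      where
      restore : ∀ r p e → r ≡ (r + p * e) - p * e
      restore = solve-∀
      factor : ∀ q p e → q * e - p * e ≡ (q - p) * e
      factor = solve-∀

  data Residue (d : ℕ) : ℤ → Set where
    residue : ∀ k (r : Fin d) → Residue d (k * + d + + toℕ r)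

  pattern even k = residue k zero
  pattern odd k = residue k (suc zero)

  residue-of : ∀ d .{{_ : ℕ.NonZero d}} a → Residue d a
  residue-of d a = subst (Residue d) (sym a≡kd+r) (residue (a /ℕ d) r)
    where
    r : Fin d
    r = fromℕ< (n%ℕd<d a d)
    a≡kd+r : a ≡ a /ℕ d * + d + + toℕ r
    a≡kd+r = trans (a≡a%ℕn+[a/ℕn]*n a d)
      (trans (ℤ.+-comm (+ (a %ℕ d)) (a /ℕ d * + d)) (cong (λ r → a /ℕ d * + d + + r) (sym (toℕ-fromℕ< _))))

  ∣-shift : ∀ {d a} c → d ∣ a ⇔ d ∣ a + c * d
  ∣-shift c = mk⇔ (λ d∣a → ∣m∣n⇒∣m+n d∣a (∣n⇒∣m*n c ∣-refl))
                  (λ d∣a+cd → ∣m+n∣n⇒∣m d∣a+cd (∣n⇒∣m*n c ∣-refl))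

  ∤-offset : ∀ {d r} k → ¬ d ∣ r → ¬ d ∣ k * d + r
  ∤-offset k d∤r d∣kd+r = d∤r (∣m+n∣m⇒∣n d∣kd+r (∣n⇒∣m*n k ∣-refl))

  offset-impossible : ∀ {d r a b} k → ¬ d ∣ r → a - b ≡ k * d + r → a ≢ b
  offset-impossible k d∤r a-b≡kd+r a≡b =
    ∤-offset k d∤r (divides 0ℤ (trans (sym a-b≡kd+r) (ℤ.i≡j⇒i-j≡0 a≡b)))

  even-∣ : ∀ k → + 2 ∣ k * + 2 + + 0
  even-∣ k = divides k (ℤ.+-identityʳ _)

  odd-∤ : ∀ k → ¬ + 2 ∣ k * + 2 + + 1
  odd-∤ k = ∤-offset k (from-no (+ 2 ∣? 1ℤ))

  2∣a⊎2∣a+1 : ∀ a → + 2 ∣ a ⊎ + 2 ∣ a + 1ℤ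
  2∣a⊎2∣a+1 a with residue-of 2 a
  ... | even k = inj₁ (even-∣ k)
  ... | odd k = inj₂ (divides (k + 1ℤ) (shape k))
    where shape : ∀ k → k * + 2 + + 1 + 1ℤ ≡ (k + 1ℤ) * + 2
          shape = solve-∀

  tri2-even : ∀ a → + 2 ∣ tri2 a
  tri2-even a with residue-of 2 a
  ... | even k = divides (k * (+ 2 * k - 1ℤ)) (shape k)
    where shape : ∀ k → (k * + 2 + + 0) * ((k * + 2 + + 0) - 1ℤ) ≡ k * (+ 2 * k - 1ℤ) * + 2
          shape = solve-∀
  ... | odd k = divides (k * (+ 2 * k + 1ℤ)) (shape k)
    where shape : ∀ k → (k * + 2 + + 1) * ((k * + 2 + + 1) - 1ℤ) ≡ k * (+ 2 * k + 1ℤ) * + 2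
          shape = solve-∀

  tri2-mod3 : ∀ x → + 3 ∣ tri2 x ⊎ + 3 ∣ tri2 x + 1ℤ
  tri2-mod3 x with residue-of 3 x
  ... | residue k zero = inj₁ (divides (k * (+ 3 * k - 1ℤ)) (shape k))
    where shape : ∀ k → (k * + 3 + + 0) * ((k * + 3 + + 0) - 1ℤ) ≡ k * (+ 3 * k - 1ℤ) * + 3
          shape = solve-∀
  ... | residue k (suc zero) = inj₁ (divides (k * (+ 3 * k + 1ℤ)) (shape k))
    where shape : ∀ k → (k * + 3 + + 1) * ((k * + 3 + + 1) - 1ℤ) ≡ k * (+ 3 * k + 1ℤ) * + 3
          shape = solve-∀
  ... | residue k (suc (suc zero)) = inj₂ (divides (+ 3 * k * k + + 3 * k + 1ℤ) (shape k))
    where shape : ∀ k → (k * + 3 + + 2) * ((k * + 3 + + 2) - 1ℤ) + 1ℤ ≡ (+ 3 * k * k + + 3 * k + 1ℤ) * + 3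
          shape = solve-∀

  square-mod3 : ∀ a → + 3 ∣ a * a ⊎ + 3 ∣ a * a - 1ℤ
  square-mod3 a with residue-of 3 a
  ... | residue k zero = inj₁ (divides (+ 3 * k * k) (shape k))
    where shape : ∀ k → (k * + 3 + + 0) * (k * + 3 + + 0) ≡ + 3 * k * k * + 3
          shape = solve-∀
  ... | residue k (suc zero) = inj₂ (divides (+ 3 * k * k + + 2 * k) (shape k))
    where shape : ∀ k → (k * + 3 + + 1) * (k * + 3 + + 1) - 1ℤ ≡ (+ 3 * k * k + + 2 * k) * + 3
          shape = solve-∀
  ... | residue k (suc (suc zero)) = inj₂ (divides (+ 3 * k * k + + 4 * k + 1ℤ) (shape k))
    where shape : ∀ k → (k * + 3 + + 2) * (k * + 3 + + 2) - 1ℤ ≡ (+ 3 * k * k + + 4 * k + 1ℤ) * + 3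
          shape = solve-∀

  ∣-difference-of-binary-residues : ∀ {d a b} e → d ∣ a ⊎ d ∣ a - e → d ∣ b ⊎ d ∣ b - e →
    ¬ d ∣ a + b - e → d ∣ a - b
  ∣-difference-of-binary-residues e (inj₁ d∣a) (inj₁ d∣b) _ = ∣m∣n⇒∣m-n d∣a d∣b
  ∣-difference-of-binary-residues {a = a} {b} e (inj₁ d∣a) (inj₂ d∣b-e) d∤a+b-e =
    contradiction (subst (_ ∣_) (regroup a b e) (∣m∣n⇒∣m+n d∣a d∣b-e)) d∤a+b-e
    where regroup : ∀ a b e → a + (b - e) ≡ a + b - e
          regroup = solve-∀
  ∣-difference-of-binary-residues {a = a} {b} e (inj₂ d∣a-e) (inj₁ d∣b) d∤a+b-e =
    contradiction (subst (_ ∣_) (regroup a b e) (∣m∣n⇒∣m+n d∣a-e d∣b)) d∤a+b-e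
    where regroup : ∀ a b e → a - e + b ≡ a + b - e
          regroup = solve-∀
  ∣-difference-of-binary-residues {a = a} {b} e (inj₂ d∣a-e) (inj₂ d∣b-e) _ =
    subst (_ ∣_) (regroup a b e) (∣m∣n⇒∣m-n d∣a-e d∣b-e)
    where regroup : ∀ a b e → a - e - (b - e) ≡ a - b
          regroup = solve-∀

  3-prime : Prime 3
  3-prime = from-yes (prime? 3)

  euclidsLemmaℤ : ∀ {p} → Prime p → ∀ a b → + p ∣ a * b → + p ∣ a ⊎ + p ∣ b
  euclidsLemmaℤ {p} p-prime a b p∣ab = Sum.map ∣ᵤ⇒∣ ∣ᵤ⇒∣
    (euclidsLemma ℤ.∣ a ∣ ℤ.∣ b ∣ p-prime (subst (p ℕ.∣_) (ℤ.abs-* a b) (∣⇒∣ᵤ p∣ab)))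

  3∣2s+3k⇒3∣s : ∀ s k → + 3 ∣ + 2 * s + + 3 * k → + 3 ∣ s
  3∣2s+3k⇒3∣s s k 3∣2s+3k =
    subst (_ ∣_) (combination s k) (∣m∣n⇒∣m-n (∣m⇒∣m*n (+ 2) 3∣2s+3k) (∣n⇒∣m*n (s + + 2 * k) ∣-refl))
    where combination : ∀ s k → (+ 2 * s + + 3 * k) * + 2 - (s + + 2 * k) * + 3 ≡ s
          combination = solve-∀

  n%3≢1⇒3∤n+2 : ∀ n → n ℕ.% 3 ≢ 1 → ¬ + 3 ∣ + n + + 2
  n%3≢1⇒3∤n+2 n n%3≢1 3∣n+2 with ∣⇒∣ᵤ 3∣n+2
  ... | ℕ.divides zero n+2≡0 = contradiction (trans (ℕ.+-comm 2 n) n+2≡0) λ ()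
  ... | ℕ.divides (suc q) n+2≡3+3q = n%3≢1 (begin
    n ℕ.% 3                   ≡⟨ cong (ℕ._% 3) (ℕ.+-cancelʳ-≡ 2 n (1 ℕ.+ q ℕ.* 3) n+2≡1+3q+2) ⟩
    (1 ℕ.+ q ℕ.* 3) ℕ.% 3     ≡⟨ [m+kn]%n≡m%n 1 q 3 ⟩
    1                         ∎)
    where
    open ≡-Reasoning
    n+2≡1+3q+2 : n ℕ.+ 2 ≡ 1 ℕ.+ q ℕ.* 3 ℕ.+ 2
    n+2≡1+3q+2 = trans n+2≡3+3q (cong suc (ℕ.+-comm 2 (q ℕ.* 3)))

  2∣⇒3∣⇒6∣ : ∀ {e} → + 2 ∣ e → + 3 ∣ e → + 6 ∣ e
  2∣⇒3∣⇒6∣ {e} (divides a e≡2a) (divides b e≡3b) = divides (a - b) (begin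
    e                              ≡⟨ thrice-minus-twice e ⟩
    e * + 3 - e * + 2              ≡⟨ cong₂ (λ p q → p * + 3 - q * + 2) e≡2a e≡3b ⟩
    a * + 2 * + 3 - b * + 3 * + 2  ≡⟨ factor a b ⟩
    (a - b) * + 6                  ∎)
    where
    open ≡-Reasoning
    thrice-minus-twice : ∀ e → e ≡ e * + 3 - e * + 2
    thrice-minus-twice = solve-∀
    factor : ∀ a b → a * + 2 * + 3 - b * + 3 * + 2 ≡ (a - b) * + 6
    factor = solve-∀

  -≡⇒≡+ : ∀ {a b c} → a - b ≡ c → a ≡ c + b
  -≡⇒≡+ {a} {b} refl = sym (restore a b)
    where restore : ∀ a b → a - b + b ≡ a
          restore = solve-∀

  -- Solutions in a box

  ℤ³ : Set
  ℤ³ = ℤ × ℤ × ℤ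

  uncurry₃ : (ℤ → ℤ → ℤ → ℤ) → ℤ³ → ℤ
  uncurry₃ f v = f (proj₁ v) (proj₁ (proj₂ v)) (proj₂ (proj₂ v))

  InBox : ℕ → ℤ³ → Set
  InBox B v = ℤ.∣ proj₁ v ∣ ≤ B × ℤ.∣ proj₁ (proj₂ v) ∣ ≤ B × ℤ.∣ proj₂ (proj₂ v) ∣ ≤ B

  ∈-window : ∀ {B} a → ℤ.∣ a ∣ ≤ B → a ∈ window B
  ∈-window {B} (+ a) a≤B =
    subst (_∈ window B) (shift a B) (∈-map⁺ _ (∈-upTo⁺ (s≤s (ℕ.+-monoˡ-≤ B a≤B))))
    where
    shift : ∀ a B → + (a ℕ.+ B) - + B ≡ + a
    shift a B = trans (cong (_- + B) (ℤ.pos-+ a B)) (cancel (+ a) (+ B))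
      where cancel : ∀ a b → a + b - b ≡ a
            cancel = solve-∀
  ∈-window {B} -[1+ a ] a<B =
    subst (_∈ window B) shift (∈-map⁺ _ (∈-upTo⁺ (s≤s (ℕ.≤-trans (ℕ.m∸n≤m B (suc a)) (ℕ.m≤m+n B B)))))
    where
    open ≡-Reasoning
    c : ℕ
    c = B ℕ.∸ suc a
    shift : + c - + B ≡ -[1+ a ]
    shift = begin
      + c - + B                ≡⟨ cong (λ b → + c - + b) (ℕ.m∸n+n≡m a<B) ⟨
      + c - + (c ℕ.+ suc a)    ≡⟨ cong (λ b → + c - b) (ℤ.pos-+ c (suc a)) ⟩
      + c - (+ c + + suc a)    ≡⟨ cancel (+ c) (+ suc a) ⟩
      - + suc a                ∎
      where cancel : ∀ c b → c - (c + b) ≡ - b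
            cancel = solve-∀

  ∈-box : ∀ {B} v → InBox B v → v ∈ box B
  ∈-box (x , y , z) (x≤B , y≤B , z≤B) =
    ∈-cartesianProduct⁺ (∈-window x x≤B) (∈-cartesianProduct⁺ (∈-window y y≤B) (∈-window z z≤B))

  window-unique : ∀ B → Unique (window B)
  window-unique B = Unique.map⁺ (λ {i} {j} → ℤ.+-injective ∘ shift-injective (+ i) (+ j)) (Unique.upTo⁺ _)
    where
    shift-injective : ∀ a b → a - + B ≡ b - + B → a ≡ b
    shift-injective a b e = trans (sym (unshift a (+ B))) (trans (cong (_+ + B) e) (unshift b (+ B)))
      where unshift : ∀ a b → a - b + b ≡ a
            unshift = solve-∀

  -- Opaque, so that type checking never unfolds `box B`.
  opaque
    solutions : ℕ → (ℤ → ℤ → ℤ → ℤ) → ℤ → List ℤ³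
    solutions B f m = filter (λ v → uncurry₃ f v ≟ m) (box B)

    countIn≡length-solutions : ∀ B f g m → (∀ x y z → f x y z ≡ g x y z) →
      countIn B f m ≡ length (solutions B g m)
    countIn≡length-solutions B f g m f≗g = cong length (filter-cong _ (λ v → uncurry₃ g v ≟ m)
      (λ { (x , y , z) → cong (λ a → does (a ≟ m)) (f≗g x y z) }) (box B))

    solutions-unique : ∀ B f m → Unique (solutions B f m)
    solutions-unique B f m = Unique.filter⁺ (λ v → uncurry₃ f v ≟ m)
      (Unique.cartesianProduct⁺ (window-unique B) (Unique.cartesianProduct⁺ (window-unique B) (window-unique B)))

    ∈-solutions⁺ : ∀ {B f m} v → InBox B v → uncurry₃ f v ≡ m → v ∈ solutions B f m
    ∈-solutions⁺ {f = f} {m} v v∈box fv≡m = ∈-filter⁺ (λ v → uncurry₃ f v ≟ m) (∈-box v v∈box) fv≡m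

    ∈-solutions⁻ : ∀ {B f m v} → v ∈ solutions B f m → uncurry₃ f v ≡ m
    ∈-solutions⁻ {f = f} {m} v∈ = proj₂ (∈-filter⁻ (λ v → uncurry₃ f v ≟ m) v∈)

  bounded-summands : ∀ {a b c N} → a ℕ.+ b ℕ.+ 27 ℕ.* c ≡ N → a ≤ N × b ≤ N × c ≤ N
  bounded-summands {a} {b} {c} refl =
    ℕ.≤-trans (ℕ.m≤m+n a b) (ℕ.m≤m+n (a ℕ.+ b) (27 ℕ.* c)) ,
    ℕ.≤-trans (ℕ.m≤n+m b a) (ℕ.m≤m+n (a ℕ.+ b) (27 ℕ.* c)) ,
    ℕ.≤-trans (ℕ.m≤n*m c 27) (ℕ.m≤n+m (27 ℕ.* c) (a ℕ.+ b))

  Q : ℤ → ℤ → ℤ → ℤ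
  Q x y z = x * x + y * y + + 27 * (z * z)

  T : ℤ → ℤ → ℤ → ℤ
  T x y z = tri2 x + tri2 y + + 27 * tri2 z

  Q-inBox : ∀ {N} v → uncurry₃ Q v ≡ + N → InBox N v
  Q-inBox {N} (x , y , z) Q≡N with bounded-summands (ℤ.+-injective (trans Q-abs Q≡N))
    where
    square-abs : ∀ a → a * a ≡ + (ℤ.∣ a ∣ ℕ.* ℤ.∣ a ∣)
    square-abs (+ n) = sym (ℤ.pos-* n n)
    square-abs -[1+ n ] = refl
    sq : ℤ → ℕ
    sq a = ℤ.∣ a ∣ ℕ.* ℤ.∣ a ∣
    Q-abs : + (sq x ℕ.+ sq y ℕ.+ 27 ℕ.* sq z) ≡ Q x y z
    Q-abs = trans (ℤ.pos-+ (sq x ℕ.+ sq y) (27 ℕ.* sq z))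
      (cong₂ _+_ (trans (ℤ.pos-+ (sq x) (sq y)) (sym (cong₂ _+_ (square-abs x) (square-abs y))))
                 (trans (ℤ.pos-* 27 (sq z)) (cong (+ 27 *_) (sym (square-abs z)))))
  ... | x²≤N , y²≤N , z²≤N = ℕ.≤-trans (n≤n*n _) x²≤N , ℕ.≤-trans (n≤n*n _) y²≤N , ℕ.≤-trans (n≤n*n _) z²≤N
    where
    n≤n*n : ∀ n → n ≤ n ℕ.* n
    n≤n*n zero = z≤n
    n≤n*n (suc n) = ℕ.m≤m*n (suc n) (suc n)

  tri2ℕ : ℤ → ℕ
  tri2ℕ (+ zero) = 0
  tri2ℕ (+ suc k) = suc k ℕ.* k
  tri2ℕ -[1+ k ] = suc k ℕ.* suc (suc k)

  tri2≡tri2ℕ : ∀ x → tri2 x ≡ + tri2ℕ x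
  tri2≡tri2ℕ (+ zero) = refl
  tri2≡tri2ℕ (+ suc k) = sym (ℤ.pos-* (suc k) k)
  tri2≡tri2ℕ -[1+ k ] = cong (λ j → + (suc k ℕ.* suc (suc j))) (ℕ.+-identityʳ k)

  2∣x∣≤tri2ℕ+2 : ∀ x → 2 ℕ.* ℤ.∣ x ∣ ≤ tri2ℕ x ℕ.+ 2
  2∣x∣≤tri2ℕ+2 (+ zero) = z≤n
  2∣x∣≤tri2ℕ+2 (+ suc k) = begin
    2 ℕ.* suc k         ≡⟨ trans (ℕ.*-suc 2 k) (ℕ.+-comm 2 (2 ℕ.* k)) ⟩
    2 ℕ.* k ℕ.+ 2       ≤⟨ ℕ.+-monoˡ-≤ 2 (2k≤[1+k]k k) ⟩
    suc k ℕ.* k ℕ.+ 2   ∎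
    where
    open ℕ.≤-Reasoning
    2k≤[1+k]k : ∀ k → 2 ℕ.* k ≤ suc k ℕ.* k
    2k≤[1+k]k zero = z≤n
    2k≤[1+k]k (suc k) = ℕ.*-monoˡ-≤ (suc k) (s≤s (s≤s (z≤n {k})))
  2∣x∣≤tri2ℕ+2 -[1+ k ] = begin
    2 ℕ.* suc k                  ≡⟨ ℕ.*-comm 2 (suc k) ⟩
    suc k ℕ.* 2                  ≤⟨ ℕ.*-monoʳ-≤ (suc k) (s≤s (s≤s z≤n)) ⟩
    suc k ℕ.* suc (suc k)        ≤⟨ ℕ.m≤m+n _ 2 ⟩
    suc k ℕ.* suc (suc k) ℕ.+ 2  ∎
    where open ℕ.≤-Reasoning

  tri2ℕ≤2n⇒∣x∣≤1+n : ∀ {n} x → tri2ℕ x ≤ 2 ℕ.* n → ℤ.∣ x ∣ ≤ suc n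
  tri2ℕ≤2n⇒∣x∣≤1+n {n} x tri2x≤2n = ℕ.*-cancelˡ-≤ 2 (begin
    2 ℕ.* ℤ.∣ x ∣       ≤⟨ 2∣x∣≤tri2ℕ+2 x ⟩
    tri2ℕ x ℕ.+ 2       ≤⟨ ℕ.+-monoˡ-≤ 2 tri2x≤2n ⟩
    2 ℕ.* n ℕ.+ 2       ≡⟨ trans (ℕ.+-comm (2 ℕ.* n) 2) (sym (ℕ.*-suc 2 n)) ⟩
    2 ℕ.* suc n         ∎)
    where open ℕ.≤-Reasoning

  T-inBox : ∀ {n} v → uncurry₃ T v ≡ + (2 ℕ.* n) → InBox (suc n) v
  T-inBox {n} (x , y , z) T≡2n with bounded-summands (ℤ.+-injective (trans T-abs T≡2n))
    where
    T-abs : + (tri2ℕ x ℕ.+ tri2ℕ y ℕ.+ 27 ℕ.* tri2ℕ z) ≡ T x y z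
    T-abs = trans (ℤ.pos-+ (tri2ℕ x ℕ.+ tri2ℕ y) (27 ℕ.* tri2ℕ z))
      (sym (cong₂ _+_ (trans (cong₂ _+_ (tri2≡tri2ℕ x) (tri2≡tri2ℕ y)) (sym (ℤ.pos-+ (tri2ℕ x) (tri2ℕ y))))
                      (trans (cong (+ 27 *_) (tri2≡tri2ℕ z)) (sym (ℤ.pos-* 27 (tri2ℕ z))))))
  ... | x≤ , y≤ , z≤ = tri2ℕ≤2n⇒∣x∣≤1+n x x≤ , tri2ℕ≤2n⇒∣x∣≤1+n y y≤ , tri2ℕ≤2n⇒∣x∣≤1+n z z≤

  -- Twisted bijections

  module Twisted
    {X Y H P : Set}
    (_·ˣ_ : H → X → X) (_·ʸ_ : H → Y → Y)
    (·ˣ-involutive : ∀ h x → h ·ˣ (h ·ˣ x) ≡ x)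
    (·ʸ-involutive : ∀ h y → h ·ʸ (h ·ʸ y) ≡ y)
    (σ : X → H) (τ : Y → H) (F : X → Y) (G : Y → X) (pˣ : P → X) (pʸ : P → Y)
    (F∘pˣ : ∀ q → F (pˣ q) ≡ pʸ q) (G∘pʸ : ∀ q → G (pʸ q) ≡ pˣ q)
    (σ-τ : ∀ h q → σ (h ·ˣ pˣ q) ≡ τ (h ·ʸ pʸ q))
    where

    open ≡-Reasoning

    φ : X → Y
    φ x = σ x ·ʸ F (σ x ·ˣ x)

    ψ : Y → X
    ψ y = τ y ·ˣ G (τ y ·ʸ y)

    φ-normal : ∀ {x q} → σ x ·ˣ x ≡ pˣ q → φ x ≡ σ x ·ʸ pʸ q
    φ-normal {x} {q} σx·x≡pq = cong (σ x ·ʸ_) (trans (cong F σx·x≡pq) (F∘pˣ q))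

    ψ∘φ : ∀ {x} → (∃ λ q → σ x ·ˣ x ≡ pˣ q) → ψ (φ x) ≡ x
    ψ∘φ {x} (q , σx·x≡pq) = begin
      τ (φ x) ·ˣ G (τ (φ x) ·ʸ φ x)        ≡⟨ cong (λ h → h ·ˣ G (h ·ʸ φ x)) τ∘φ ⟩
      σ x ·ˣ G (σ x ·ʸ φ x)                ≡⟨ cong (λ y → σ x ·ˣ G (σ x ·ʸ y)) (φ-normal σx·x≡pq) ⟩
      σ x ·ˣ G (σ x ·ʸ (σ x ·ʸ pʸ q))      ≡⟨ cong (λ y → σ x ·ˣ G y) (·ʸ-involutive (σ x) (pʸ q)) ⟩
      σ x ·ˣ G (pʸ q)                      ≡⟨ cong (σ x ·ˣ_) (G∘pʸ q) ⟩
      σ x ·ˣ pˣ q                          ≡⟨ cong (σ x ·ˣ_) σx·x≡pq ⟨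
      σ x ·ˣ (σ x ·ˣ x)                    ≡⟨ ·ˣ-involutive (σ x) x ⟩
      x                                    ∎
      where
      τ∘φ : τ (φ x) ≡ σ x
      τ∘φ = begin
        τ (φ x)                  ≡⟨ cong τ (φ-normal σx·x≡pq) ⟩
        τ (σ x ·ʸ pʸ q)          ≡⟨ σ-τ (σ x) q ⟨
        σ (σ x ·ˣ pˣ q)          ≡⟨ cong (λ p → σ (σ x ·ˣ p)) σx·x≡pq ⟨
        σ (σ x ·ˣ (σ x ·ˣ x))    ≡⟨ cong σ (·ˣ-involutive (σ x) x) ⟩
        σ x                      ∎

  -- Sign changes and the maps M, M/4

  reflectUnless : Bool → ℤ → ℤ
  reflectUnless true a = a
  reflectUnless false a = 1ℤ - a

  negateUnless : Bool → ℤ → ℤ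
  negateUnless true a = a
  negateUnless false a = - a

  reflectUnless-involutive : ∀ b a → reflectUnless b (reflectUnless b a) ≡ a
  reflectUnless-involutive true a = refl
  reflectUnless-involutive false a = reflect² a
    where reflect² : ∀ a → 1ℤ - (1ℤ - a) ≡ a
          reflect² = solve-∀

  negateUnless-involutive : ∀ b a → negateUnless b (negateUnless b a) ≡ a
  negateUnless-involutive true a = refl
  negateUnless-involutive false a = ℤ.neg-involutive a

  tri2-reflectUnless : ∀ b a → tri2 (reflectUnless b a) ≡ tri2 a
  tri2-reflectUnless true a = refl
  tri2-reflectUnless false a = tri2-reflect a
    where tri2-reflect : ∀ a → (1ℤ - a) * ((1ℤ - a) - 1ℤ) ≡ a * (a - 1ℤ)
          tri2-reflect = solve-∀

  square-negateUnless : ∀ b a → negateUnless b a * negateUnless b a ≡ a * a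
  square-negateUnless true a = refl
  square-negateUnless false a = square-neg a
    where square-neg : ∀ a → - a * - a ≡ a * a
          square-neg = solve-∀

  _·ᴬ_ : Bool × Bool → ℤ³ → ℤ³
  (b , c) ·ᴬ (x , y , z) = x , reflectUnless b y , reflectUnless c z

  _·ᴮ_ : Bool × Bool → ℤ³ → ℤ³
  (b , c) ·ᴮ (U , V , W) = U , negateUnless b V , negateUnless c W

  ·ᴬ-involutive : ∀ h v → h ·ᴬ (h ·ᴬ v) ≡ v
  ·ᴬ-involutive (b , c) (x , y , z) =
    cong₂ (λ y z → x , y , z) (reflectUnless-involutive b y) (reflectUnless-involutive c z)

  ·ᴮ-involutive : ∀ h v → h ·ᴮ (h ·ᴮ v) ≡ v
  ·ᴮ-involutive (b , c) (U , V , W) =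
    cong₂ (λ V W → U , V , W) (negateUnless-involutive b V) (negateUnless-involutive c W)

  T-·ᴬ : ∀ h v → uncurry₃ T (h ·ᴬ v) ≡ uncurry₃ T v
  T-·ᴬ (b , c) (x , y , z) =
    cong₂ (λ p q → tri2 x + p + + 27 * q) (tri2-reflectUnless b y) (tri2-reflectUnless c z)

  Q-·ᴮ : ∀ h v → uncurry₃ Q (h ·ᴮ v) ≡ uncurry₃ Q v
  Q-·ᴮ (b , c) (U , V , W) =
    cong₂ (λ p q → U * U + p + + 27 * q) (square-negateUnless b V) (square-negateUnless c W)

  σ : ℤ³ → Bool × Bool
  σ (x , y , z) = does (+ 3 ∣? x + y - 1ℤ) , does (+ 2 ∣? x + z)

  τ : ℤ³ → Bool × Bool
  τ (U , V , W) = does (+ 3 ∣? U + V) , does (+ 4 ∣? U - W)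

  -- In the coordinates a = 2x - 1, b = 2y - 1, c = 2z - 1, F is the map M of the header, and G is M/4
  -- written back in x, y, z; the divisions are exact on the images of pᴬ and pᴮ below.
  F : ℤ³ → ℤ³
  F (x , y , z) = + 3 * x + + 2 * y + + 9 * z - + 7 , + 2 * x - + 18 * z + + 8 , x + z - 1ℤ - + 2 * ((x + y - 1ℤ) /ℕ 3)

  G : ℤ³ → ℤ³
  G (U , V , W) = (+ 3 * U + + 2 * V + + 9 * W + + 8) /ℕ 16 , (U - + 9 * W + + 4) /ℕ 8 , (U - + 2 * V + + 3 * W + + 24) /ℕ 48

  -- pᴬ parametrises the normal triples (3 ∣ x + y - 1, 2 ∣ x + z) by k = (x + y - 1)/3, j = (x + z)/2
  -- and z, and pᴮ = F ∘ pᴬ.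
  pᴬ : ℤ³ → ℤ³
  pᴬ (k , j , z) = + 2 * j - z , + 3 * k + 1ℤ - + 2 * j + z , z

  pᴮ : ℤ³ → ℤ³
  pᴮ (k , j , z) = + 2 * j + + 6 * k + + 8 * z - + 5 , + 4 * j - + 20 * z + + 8 , + 2 * j - + 2 * k - 1ℤ

  F∘pᴬ : ∀ q → F (pᴬ q) ≡ pᴮ q
  F∘pᴬ (k , j , z) = cong₂ _,_ (first k j z) (cong₂ _,_ (second k j z) (begin
      x + z - 1ℤ - + 2 * ((x + y - 1ℤ) /ℕ 3)    ≡⟨ cong (λ e → x + z - 1ℤ - + 2 * (e /ℕ 3)) (x+y-1 k j z) ⟩
      x + z - 1ℤ - + 2 * ((k * + 3) /ℕ 3)       ≡⟨ cong (λ e → x + z - 1ℤ - + 2 * e) (/ℕ-exact 3 k) ⟩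
      x + z - 1ℤ - + 2 * k                      ≡⟨ third k j z ⟩
      + 2 * j - + 2 * k - 1ℤ                    ∎))
    where
    open ≡-Reasoning
    x : ℤ
    x = + 2 * j - z
    y : ℤ
    y = + 3 * k + 1ℤ - + 2 * j + z
    first : ∀ k j z → + 3 * (+ 2 * j - z) + + 2 * (+ 3 * k + 1ℤ - + 2 * j + z) + + 9 * z - + 7 ≡ + 2 * j + + 6 * k + + 8 * z - + 5
    first = solve-∀
    second : ∀ k j z → + 2 * (+ 2 * j - z) - + 18 * z + + 8 ≡ + 4 * j - + 20 * z + + 8
    second = solve-∀
    x+y-1 : ∀ k j z → (+ 2 * j - z) + (+ 3 * k + 1ℤ - + 2 * j + z) - 1ℤ ≡ k * + 3
    x+y-1 = solve-∀
    third : ∀ k j z → (+ 2 * j - z) + z - 1ℤ - + 2 * k ≡ + 2 * j - + 2 * k - 1ℤ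
    third = solve-∀

  G∘pᴮ : ∀ q → G (pᴮ q) ≡ pᴬ q
  G∘pᴮ (k , j , z) = cong₂ _,_ (exactly 16 (first k j z)) (cong₂ _,_ (exactly 8 (second k j z)) (exactly 48 (third k j z)))
    where
    exactly : ∀ d .{{_ : ℕ.NonZero d}} {a q} → a ≡ q * + d → a /ℕ d ≡ q
    exactly d {q = q} refl = /ℕ-exact d q
    first : ∀ k j z → + 3 * (+ 2 * j + + 6 * k + + 8 * z - + 5) + + 2 * (+ 4 * j - + 20 * z + + 8) + + 9 * (+ 2 * j - + 2 * k - 1ℤ) + + 8 ≡ (+ 2 * j - z) * + 16
    first = solve-∀
    second : ∀ k j z → (+ 2 * j + + 6 * k + + 8 * z - + 5) - + 9 * (+ 2 * j - + 2 * k - 1ℤ) + + 4 ≡ (+ 3 * k + 1ℤ - + 2 * j + z) * + 8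
    second = solve-∀
    third : ∀ k j z → (+ 2 * j + + 6 * k + + 8 * z - + 5) - + 2 * (+ 4 * j - + 20 * z + + 8) + + 3 * (+ 2 * j - + 2 * k - 1ℤ) + + 24 ≡ z * + 48
    third = solve-∀

  Q∘pᴮ : ∀ q → uncurry₃ Q (pᴮ q) ≡ + 16 * uncurry₃ T (pᴬ q) + + 116
  Q∘pᴮ (k , j , z) = identity k j z
    where
    identity : ∀ k j z →
      let U = + 2 * j + + 6 * k + + 8 * z - + 5 ; V = + 4 * j - + 20 * z + + 8 ; W = + 2 * j - + 2 * k - 1ℤ
          x : ℤ
          x = + 2 * j - z ; y = + 3 * k + 1ℤ - + 2 * j + z in
      U * U + V * V + + 27 * (W * W) ≡ + 16 * (x * (x - 1ℤ) + y * (y - 1ℤ) + + 27 * (z * (z - 1ℤ))) + + 116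
    identity = solve-∀

  σ-τ : ∀ h q → σ (h ·ᴬ pᴬ q) ≡ τ (h ·ᴮ pᴮ q)
  σ-τ (b , c) (k , j , z) = cong₂ _,_ (3-part b) (2-part c)
    where
    x : ℤ
    x = + 2 * j - z
    y : ℤ
    y = + 3 * k + 1ℤ - + 2 * j + z
    U : ℤ
    U = + 2 * j + + 6 * k + + 8 * z - + 5
    V : ℤ
    V = + 4 * j - + 20 * z + + 8
    W : ℤ
    W = + 2 * j - + 2 * k - 1ℤ
    3-part : ∀ b → does (+ 3 ∣? x + reflectUnless b y - 1ℤ) ≡ does (+ 3 ∣? U + negateUnless b V)
    3-part true = trans (dec-true (+ 3 ∣? x + y - 1ℤ) (divides k (x+y-1 k j z)))
                        (sym (dec-true (+ 3 ∣? U + V) (divides (+ 2 * j + + 2 * k - + 4 * z + 1ℤ) (U+V k j z))))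
      where
      x+y-1 : ∀ k j z → (+ 2 * j - z) + (+ 3 * k + 1ℤ - + 2 * j + z) - 1ℤ ≡ k * + 3
      x+y-1 = solve-∀
      U+V : ∀ k j z → (+ 2 * j + + 6 * k + + 8 * z - + 5) + (+ 4 * j - + 20 * z + + 8) ≡ (+ 2 * j + + 2 * k - + 4 * z + 1ℤ) * + 3
      U+V = solve-∀
    3-part false = does-⇔ equivalence (+ 3 ∣? x + (1ℤ - y) - 1ℤ) (+ 3 ∣? U + - V)
      where
      U-V : ∀ k j z → (+ 2 * j + + 6 * k + + 8 * z - + 5) + - (+ 4 * j - + 20 * z + + 8)
                     ≡ (+ 2 * j - z) + (1ℤ - (+ 3 * k + 1ℤ - + 2 * j + z)) - 1ℤ + (- + 2 * j + + 3 * k + + 10 * z - + 4) * + 3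
      U-V = solve-∀
      equivalence : + 3 ∣ x + (1ℤ - y) - 1ℤ ⇔ + 3 ∣ U + - V
      equivalence = subst (λ e → + 3 ∣ x + (1ℤ - y) - 1ℤ ⇔ + 3 ∣ e) (sym (U-V k j z)) (∣-shift (- + 2 * j + + 3 * k + + 10 * z - + 4))
    2-part : ∀ c → does (+ 2 ∣? x + reflectUnless c z) ≡ does (+ 4 ∣? U - negateUnless c W)
    2-part true = trans (dec-true (+ 2 ∣? x + z) (divides j (x+z j z)))
                        (sym (dec-true (+ 4 ∣? U - W) (divides (+ 2 * k + + 2 * z - 1ℤ) (U-W k j z))))
      where
      x+z : ∀ j z → (+ 2 * j - z) + z ≡ j * + 2
      x+z = solve-∀
      U-W : ∀ k j z → (+ 2 * j + + 6 * k + + 8 * z - + 5) - (+ 2 * j - + 2 * k - 1ℤ) ≡ (+ 2 * k + + 2 * z - 1ℤ) * + 4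
      U-W = solve-∀
    2-part false = trans (dec-false (+ 2 ∣? x + (1ℤ - z)) (subst (λ e → ¬ + 2 ∣ e) (sym (x+1-z j z)) (∤-offset (j - z) (from-no (+ 2 ∣? 1ℤ)))))
                         (sym (dec-false (+ 4 ∣? U - - W) (subst (λ e → ¬ + 4 ∣ e) (sym (U+W k j z)) (∤-offset (j + k + + 2 * z - + 2) (from-no (+ 4 ∣? + 2))))))
      where
      x+1-z : ∀ j z → (+ 2 * j - z) + (1ℤ - z) ≡ (j - z) * + 2 + 1ℤ
      x+1-z = solve-∀
      U+W : ∀ k j z → (+ 2 * j + + 6 * k + + 8 * z - + 5) - - (+ 2 * j - + 2 * k - 1ℤ) ≡ (j + k + + 2 * z - + 2) * + 4 + + 2
      U+W = solve-∀

  -- Normal forms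

  3∣x+y-1⊎3∣x-y : ∀ N x y z → ¬ + 3 ∣ N + + 2 → T x y z ≡ + 2 * N → + 3 ∣ x + y - 1ℤ ⊎ + 3 ∣ x - y
  3∣x+y-1⊎3∣x-y N x y z 3∤N+2 T≡2N = euclidsLemmaℤ 3-prime (x + y - 1ℤ) (x - y)
    (subst (+ 3 ∣_) (factor x y) (∣-difference-of-binary-residues (- 1ℤ) (tri2-mod3 x) (tri2-mod3 y) 3∤sum))
    where
    open ≡-Reasoning
    factor : ∀ x y → x * (x - 1ℤ) - y * (y - 1ℤ) ≡ (x + y - 1ℤ) * (x - y)
    factor = solve-∀
    sum≡ : tri2 x + tri2 y + 1ℤ ≡ + 2 * (N + + 2) + + 3 * (- 1ℤ - + 9 * tri2 z)
    sum≡ = begin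
      tri2 x + tri2 y + 1ℤ                    ≡⟨ isolate (tri2 x) (tri2 y) (tri2 z) ⟩
      T x y z + 1ℤ - + 27 * tri2 z            ≡⟨ cong (λ s → s + 1ℤ - + 27 * tri2 z) T≡2N ⟩
      + 2 * N + 1ℤ - + 27 * tri2 z            ≡⟨ regroup N (tri2 z) ⟩
      + 2 * (N + + 2) + + 3 * (- 1ℤ - + 9 * tri2 z) ∎
      where
      isolate : ∀ a b c → a + b + 1ℤ ≡ a + b + + 27 * c + 1ℤ - + 27 * c
      isolate = solve-∀
      regroup : ∀ N c → + 2 * N + 1ℤ - + 27 * c ≡ + 2 * (N + + 2) + + 3 * (- 1ℤ - + 9 * c)
      regroup = solve-∀
    3∤sum : ¬ + 3 ∣ tri2 x + tri2 y - - 1ℤ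
    3∤sum 3∣sum = 3∤N+2 (3∣2s+3k⇒3∣s (N + + 2) _ (subst (+ 3 ∣_) sum≡ 3∣sum))

  3∣U+V⊎3∣U-V : ∀ N U V W → ¬ + 3 ∣ N + + 2 → Q U V W ≡ + 4 * (+ 8 * N + + 29) → + 3 ∣ U + V ⊎ + 3 ∣ U - V
  3∣U+V⊎3∣U-V N U V W 3∤N+2 Q≡4m = euclidsLemmaℤ 3-prime (U + V) (U - V)
    (subst (+ 3 ∣_) (factor U V) (∣-difference-of-binary-residues 1ℤ (square-mod3 U) (square-mod3 V) 3∤sum))
    where
    open ≡-Reasoning
    factor : ∀ U V → U * U - V * V ≡ (U + V) * (U - V)
    factor = solve-∀
    sum≡ : U * U + V * V - 1ℤ ≡ + 2 * (N + + 2) + + 3 * (+ 10 * N + + 37 - + 9 * (W * W))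
    sum≡ = begin
      U * U + V * V - 1ℤ                  ≡⟨ isolate (U * U) (V * V) (W * W) ⟩
      Q U V W - 1ℤ - + 27 * (W * W)       ≡⟨ cong (λ s → s - 1ℤ - + 27 * (W * W)) Q≡4m ⟩
      + 4 * (+ 8 * N + + 29) - 1ℤ - + 27 * (W * W)  ≡⟨ regroup N (W * W) ⟩
      + 2 * (N + + 2) + + 3 * (+ 10 * N + + 37 - + 9 * (W * W)) ∎
      where
      isolate : ∀ a b c → a + b - 1ℤ ≡ a + b + + 27 * c - 1ℤ - + 27 * c
      isolate = solve-∀
      regroup : ∀ N c → + 4 * (+ 8 * N + + 29) - 1ℤ - + 27 * c ≡ + 2 * (N + + 2) + + 3 * (+ 10 * N + + 37 - + 9 * c)
      regroup = solve-∀
    3∤sum : ¬ + 3 ∣ U * U + V * V - 1ℤ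
    3∤sum 3∣sum = 3∤N+2 (3∣2s+3k⇒3∣s (N + + 2) _ (subst (+ 3 ∣_) sum≡ 3∣sum))

  Q-residue-mod4 : ∀ u v w r s t → Q (u * + 2 + r) (v * + 2 + s) (w * + 2 + t)
    ≡ (u * u + u * r + v * v + v * s + + 27 * (w * w + w * t)) * + 4 + Q r s t
  Q-residue-mod4 u v w r s t = expand u v w r s t
    where
    expand : ∀ u v w r s t → (u * + 2 + r) * (u * + 2 + r) + (v * + 2 + s) * (v * + 2 + s) + + 27 * ((w * + 2 + t) * (w * + 2 + t))
      ≡ (u * u + u * r + v * v + v * s + + 27 * (w * w + w * t)) * + 4 + (r * r + s * s + + 27 * (t * t))
    expand = solve-∀

  4∤Q-residue : ∀ u v w r s t → ¬ + 4 ∣ Q r s t → ¬ + 4 ∣ Q (u * + 2 + r) (v * + 2 + s) (w * + 2 + t)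
  4∤Q-residue u v w r s t 4∤Qrst = subst (λ e → ¬ + 4 ∣ e) (sym (Q-residue-mod4 u v w r s t))
    (∤-offset (u * u + u * r + v * v + v * s + + 27 * (w * w + w * t)) 4∤Qrst)

  4∣Q⇒parities : ∀ U V W → + 4 ∣ Q U V W → (¬ + 2 ∣ U → + 2 ∣ V × ¬ + 2 ∣ W) × (+ 2 ∣ U → + 2 ∣ V → + 2 ∣ W)
  4∣Q⇒parities U V W 4∣Q with residue-of 2 U | residue-of 2 V | residue-of 2 W
  ... | even u | even v | even w = (λ 2∤U → contradiction (even-∣ u) 2∤U) , λ _ _ → even-∣ w
  ... | even u | even v | odd w  = contradiction 4∣Q (4∤Q-residue u v w 0ℤ 0ℤ 1ℤ (from-no (+ 4 ∣? + 27)))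
  ... | even u | odd v  | _ = (λ 2∤U → contradiction (even-∣ u) 2∤U) , λ _ 2∣V → contradiction 2∣V (odd-∤ v)
  ... | odd u  | even v | odd w  = (λ _ → even-∣ v , odd-∤ w) , λ 2∣U → contradiction 2∣U (odd-∤ u)
  ... | odd u  | even v | even w = contradiction 4∣Q (4∤Q-residue u v w 1ℤ 0ℤ 0ℤ (from-no (+ 4 ∣? 1ℤ)))
  ... | odd u  | odd v  | even w = contradiction 4∣Q (4∤Q-residue u v w 1ℤ 1ℤ 0ℤ (from-no (+ 4 ∣? + 2)))
  ... | odd u  | odd v  | odd w  = contradiction 4∣Q (4∤Q-residue u v w 1ℤ 1ℤ 1ℤ (from-no (+ 4 ∣? + 29)))

  4∣U-W⊎4∣U+W : ∀ U W → ¬ + 2 ∣ U → ¬ + 2 ∣ W → + 4 ∣ U - W ⊎ + 4 ∣ U + W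
  4∣U-W⊎4∣U+W U W 2∤U 2∤W with residue-of 2 U | residue-of 2 W
  ... | even u | _ = contradiction (even-∣ u) 2∤U
  ... | odd u | even w = contradiction (even-∣ w) 2∤W
  ... | odd u | odd w with 2∣a⊎2∣a+1 (u - w)
  ...   | inj₁ (divides a u-w≡2a) = inj₁ (divides a (begin
          (u * + 2 + + 1) - (w * + 2 + + 1)   ≡⟨ difference u w ⟩
          (u - w) * + 2                       ≡⟨ cong (_* + 2) u-w≡2a ⟩
          a * + 2 * + 2                       ≡⟨ ℤ.*-assoc a (+ 2) (+ 2) ⟩
          a * + 4                             ∎))
    where
    open ≡-Reasoning
    difference : ∀ u w → (u * + 2 + + 1) - (w * + 2 + + 1) ≡ (u - w) * + 2
    difference = solve-∀
  ...   | inj₂ (divides a u-w+1≡2a) = inj₂ (divides (a + w) (begin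
          (u * + 2 + + 1) + (w * + 2 + + 1)   ≡⟨ sum u w ⟩
          (u - w + 1ℤ) * + 2 + w * + 4        ≡⟨ cong (λ e → e * + 2 + w * + 4) u-w+1≡2a ⟩
          a * + 2 * + 2 + w * + 4             ≡⟨ regroup a w ⟩
          (a + w) * + 4                       ∎))
    where
    open ≡-Reasoning
    sum : ∀ u w → (u * + 2 + + 1) + (w * + 2 + + 1) ≡ (u - w + 1ℤ) * + 2 + w * + 4
    sum = solve-∀
    regroup : ∀ a w → a * + 2 * + 2 + w * + 4 ≡ (a + w) * + 4
    regroup = solve-∀

  -- For W = 2w + 1, U = W + 4t and V = 2v, the equation forces v = 2v′, t = 2t′ + 1 and
  -- 2 ∣ w + t′ + v′ (working modulo 8, 16 and 32); only then is a normal triple in the image of pᴮ.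
  module _ (N w : ℤ) where

    private
      W : ℤ
      W = w * + 2 + + 1

    Q≢4m-if-V≡2mod4 : ∀ t v → Q (t * + 4 + W) ((v * + 2 + + 1) * + 2) W ≢ + 4 * (+ 8 * N + + 29)
    Q≢4m-if-V≡2mod4 t v = offset-impossible K (from-no (+ 8 ∣? + 4)) (expand N w t v)
      where
      K : ℤ
      K = - + 11 - + 4 * N + t + + 2 * t * w + + 2 * t * t + + 2 * v + + 2 * v * v + + 14 * w + + 14 * w * w
      expand : ∀ N w t v → let W = w * + 2 + + 1 in
        (t * + 4 + W) * (t * + 4 + W) + ((v * + 2 + + 1) * + 2) * ((v * + 2 + + 1) * + 2) + + 27 * (W * W) - + 4 * (+ 8 * N + + 29)
        ≡ (- + 11 - + 4 * N + t + + 2 * t * w + + 2 * t * t + + 2 * v + + 2 * v * v + + 14 * w + + 14 * w * w) * + 8 + + 4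
      expand = solve-∀

    Q≢4m-if-U-W≡0mod8 : ∀ t v → Q ((t * + 2 + + 0) * + 4 + W) ((v * + 2 + + 0) * + 2) W ≢ + 4 * (+ 8 * N + + 29)
    Q≢4m-if-U-W≡0mod8 t v = offset-impossible K (from-no (+ 16 ∣? + 8)) (expand N w t v)
      where
      K : ℤ
      K = - + 6 - + 2 * N + t + + 2 * t * w + + 4 * t * t + v * v + + 7 * w + + 7 * w * w
      expand : ∀ N w t v → let W = w * + 2 + + 1 in
        ((t * + 2 + + 0) * + 4 + W) * ((t * + 2 + + 0) * + 4 + W) + ((v * + 2 + + 0) * + 2) * ((v * + 2 + + 0) * + 2) + + 27 * (W * W) - + 4 * (+ 8 * N + + 29)
        ≡ (- + 6 - + 2 * N + t + + 2 * t * w + + 4 * t * t + v * v + + 7 * w + + 7 * w * w) * + 16 + + 8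
      expand = solve-∀

    2∣w+t+v : ∀ t v → Q ((t * + 2 + + 1) * + 4 + W) ((v * + 2 + + 0) * + 2) W ≡ + 4 * (+ 8 * N + + 29) →
      + 2 ∣ w + t + v
    2∣w+t+v t v Q≡4m = subst (+ 2 ∣_) (sym w+t+v≡)
      (∣m∣n⇒∣m-n (∣m∣n⇒∣m-n (divides M (ℤ.*-comm (+ 2) M)) (tri2-even v)) (∣n⇒∣m*n (+ 7) (tri2-even w)))
      where
      open ≡-Reasoning
      L : ℤ
      L = v * v + + 7 * w * w + + 8 * w + + 2 * t * w + + 5 * t + + 4 * t * t - + 4
      M : ℤ
      M = N + + 2 - + 7 * w - t * w - + 2 * t - + 2 * t * t
      expand : ∀ N w t v → let W = w * + 2 + + 1 in
        ((t * + 2 + + 1) * + 4 + W) * ((t * + 2 + + 1) * + 4 + W) + ((v * + 2 + + 0) * + 2) * ((v * + 2 + + 0) * + 2) + + 27 * (W * W) - + 4 * (+ 8 * N + + 29)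
        ≡ + 16 * ((v * v + + 7 * w * w + + 8 * w + + 2 * t * w + + 5 * t + + 4 * t * t - + 4) - + 2 * N)
      expand = solve-∀
      L≡2N : L - + 2 * N ≡ 0ℤ
      L≡2N = ℤ.*-cancelˡ-≡ (+ 16) (L - + 2 * N) 0ℤ (trans (sym (expand N w t v)) (ℤ.i≡j⇒i-j≡0 Q≡4m))
      regroup : ∀ N w t v → w + t + v
        ≡ ((v * v + + 7 * w * w + + 8 * w + + 2 * t * w + + 5 * t + + 4 * t * t - + 4) - + 2 * N)
          + (+ 2 * (N + + 2 - + 7 * w - t * w - + 2 * t - + 2 * t * t) - v * (v - + 1) - + 7 * (w * (w - + 1)))
      regroup = solve-∀
      w+t+v≡ : w + t + v ≡ + 2 * M - tri2 v - + 7 * tri2 w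
      w+t+v≡ = begin
        w + t + v                                       ≡⟨ regroup N w t v ⟩
        (L - + 2 * N) + (+ 2 * M - tri2 v - + 7 * tri2 w) ≡⟨ cong (_+ (+ 2 * M - tri2 v - + 7 * tri2 w)) L≡2N ⟩
        0ℤ + (+ 2 * M - tri2 v - + 7 * tri2 w)          ≡⟨ ℤ.+-identityˡ _ ⟩
        + 2 * M - tri2 v - + 7 * tri2 w                 ∎

    ∈-image-pᴮ′ : ∀ t v → let U = (t * + 2 + + 1) * + 4 + W ; V = (v * + 2 + + 0) * + 2 in
      Q U V W ≡ + 4 * (+ 8 * N + + 29) → + 3 ∣ U + V → ∃ λ q → (U , V , W) ≡ pᴮ q
    ∈-image-pᴮ′ t v Q≡4m 3∣U+V = from-6∣e (2∣⇒3∣⇒6∣ 2∣e 3∣e)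
      where
      e : ℤ
      e = v - w + + 5 * t + + 2
      2∣e : + 2 ∣ e
      2∣e = subst (+ 2 ∣_) (sym (e≡ w t v)) (Equivalence.to (∣-shift (+ 2 * t - w + 1ℤ)) (2∣w+t+v t v Q≡4m))
        where e≡ : ∀ w t v → v - w + + 5 * t + + 2 ≡ w + t + v + (+ 2 * t - w + 1ℤ) * + 2
              e≡ = solve-∀
      3∣e : + 3 ∣ e
      3∣e = subst (+ 3 ∣_) (sym (e≡ w t v)) (Equivalence.to (∣-shift (- v - w - t - 1ℤ)) 3∣U+V)
        where e≡ : ∀ w t v → v - w + + 5 * t + + 2
                   ≡ ((t * + 2 + + 1) * + 4 + (w * + 2 + + 1)) + (v * + 2 + + 0) * + 2 + (- v - w - t - 1ℤ) * + 3
              e≡ = solve-∀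
      from-6∣e : + 6 ∣ e → ∃ λ q → ((t * + 2 + + 1) * + 4 + W , (v * + 2 + + 0) * + 2 , W) ≡ pᴮ q
      from-6∣e (divides k e≡6k) = (k , w + 1ℤ + k , t + 1ℤ - k) , cong₂ _,_ (U≡ w t k) (cong₂ _,_ V≡ (W≡ w k))
        where
        open ≡-Reasoning
        U≡ : ∀ w t k → (t * + 2 + + 1) * + 4 + (w * + 2 + + 1) ≡ + 2 * (w + 1ℤ + k) + + 6 * k + + 8 * (t + 1ℤ - k) - + 5
        U≡ = solve-∀
        W≡ : ∀ w k → w * + 2 + + 1 ≡ + 2 * (w + 1ℤ + k) - + 2 * k - 1ℤ
        W≡ = solve-∀
        V≡ : (v * + 2 + + 0) * + 2 ≡ + 4 * (w + 1ℤ + k) - + 20 * (t + 1ℤ - k) + + 8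
        V≡ = begin
          (v * + 2 + + 0) * + 2                               ≡⟨ by-e w t v ⟩
          + 4 * (v - w + + 5 * t + + 2) + + 4 * w - + 20 * t - + 8 ≡⟨ cong (λ e → + 4 * e + + 4 * w - + 20 * t - + 8) e≡6k ⟩
          + 4 * (k * + 6) + + 4 * w - + 20 * t - + 8          ≡⟨ by-k w t k ⟩
          + 4 * (w + 1ℤ + k) - + 20 * (t + 1ℤ - k) + + 8      ∎
          where
          by-e : ∀ w t v → (v * + 2 + + 0) * + 2 ≡ + 4 * (v - w + + 5 * t + + 2) + + 4 * w - + 20 * t - + 8
          by-e = solve-∀
          by-k : ∀ w t k → + 4 * (k * + 6) + + 4 * w - + 20 * t - + 8 ≡ + 4 * (w + 1ℤ + k) - + 20 * (t + 1ℤ - k) + + 8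
          by-k = solve-∀

  ∈-image-pᴮ : ∀ N U V W → Q U V W ≡ + 4 * (+ 8 * N + + 29) → + 2 ∣ V → ¬ + 2 ∣ W → + 4 ∣ U - W → + 3 ∣ U + V →
    ∃ λ q → (U , V , W) ≡ pᴮ q
  ∈-image-pᴮ N U .(v * + 2) W Q≡4m (divides v refl) 2∤W (divides t U-W≡4t) 3∣U+V
    with refl ← -≡⇒≡+ {U} {W} U-W≡4t | residue-of 2 W
  ... | even w = contradiction (even-∣ w) 2∤W
  ... | odd w with residue-of 2 v | residue-of 2 t
  ...   | odd v′  | _       = contradiction Q≡4m (Q≢4m-if-V≡2mod4 N w t v′)
  ...   | even v′ | even t′ = contradiction Q≡4m (Q≢4m-if-U-W≡0mod8 N w t′ v′)
  ...   | even v′ | odd t′  = ∈-image-pᴮ′ N w t′ v′ Q≡4m 3∣U+V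

  ∈-image-pᴬ : ∀ x y z → + 3 ∣ x + y - 1ℤ → + 2 ∣ x + z → ∃ λ q → (x , y , z) ≡ pᴬ q
  ∈-image-pᴬ x y z (divides k x+y-1≡3k) (divides j x+z≡2j) = (k , j , z) , cong₂ _,_ x≡ (cong (_, z) y≡)
    where
    open ≡-Reasoning
    x≡ : x ≡ + 2 * j - z
    x≡ = begin
      x             ≡⟨ restore x z ⟩
      (x + z) - z   ≡⟨ cong (_- z) x+z≡2j ⟩
      j * + 2 - z   ≡⟨ cong (_- z) (ℤ.*-comm j (+ 2)) ⟩
      + 2 * j - z   ∎
      where restore : ∀ x z → x ≡ (x + z) - z
            restore = solve-∀
    y≡ : y ≡ + 3 * k + 1ℤ - + 2 * j + z
    y≡ = begin
      y                               ≡⟨ restore x y ⟩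
      (x + y - 1ℤ) + 1ℤ - x           ≡⟨ cong₂ (λ s x → s + 1ℤ - x) x+y-1≡3k x≡ ⟩
      k * + 3 + 1ℤ - (+ 2 * j - z)    ≡⟨ regroup k j z ⟩
      + 3 * k + 1ℤ - + 2 * j + z      ∎
      where restore : ∀ x y → y ≡ (x + y - 1ℤ) + 1ℤ - x
            restore = solve-∀
            regroup : ∀ k j z → k * + 3 + 1ℤ - (+ 2 * j - z) ≡ + 3 * k + 1ℤ - + 2 * j + z
            regroup = solve-∀

  σ-normalises : ∀ N v → ¬ + 3 ∣ N + + 2 → uncurry₃ T v ≡ + 2 * N → ∃ λ q → σ v ·ᴬ v ≡ pᴬ q
  σ-normalises N (x , y , z) 3∤N+2 T≡2N = ∈-image-pᴬ x _ _ 3-normal 2-normal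
    where
    3-normal : + 3 ∣ x + reflectUnless (does (+ 3 ∣? x + y - 1ℤ)) y - 1ℤ
    3-normal = does-elim (+ 3 ∣? x + y - 1ℤ) (λ b → + 3 ∣ x + reflectUnless b y - 1ℤ) (λ 3∣x+y-1 → 3∣x+y-1)
      λ 3∤x+y-1 → subst (+ 3 ∣_) (reflect x y)
        (fromInj₂ (λ 3∣x+y-1 → contradiction 3∣x+y-1 3∤x+y-1) (3∣x+y-1⊎3∣x-y N x y z 3∤N+2 T≡2N))
      where reflect : ∀ x y → x - y ≡ x + (1ℤ - y) - 1ℤ
            reflect = solve-∀
    2-normal : + 2 ∣ x + reflectUnless (does (+ 2 ∣? x + z)) z
    2-normal = does-elim (+ 2 ∣? x + z) (λ b → + 2 ∣ x + reflectUnless b z) (λ 2∣x+z → 2∣x+z)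
      λ 2∤x+z → subst (+ 2 ∣_) (reflect x z)
        (∣m∣n⇒∣m-n (fromInj₂ (λ 2∣x+z → contradiction 2∣x+z 2∤x+z) (2∣a⊎2∣a+1 (x + z))) (∣n⇒∣m*n z ∣-refl))
      where reflect : ∀ x z → x + z + 1ℤ - z * + 2 ≡ x + (1ℤ - z)
            reflect = solve-∀

  ∣-negateUnless : ∀ b {d a} → d ∣ negateUnless b a ⇔ d ∣ a
  ∣-negateUnless true = mk⇔ (λ p → p) (λ p → p)
  ∣-negateUnless false {a = a} = mk⇔ (λ p → subst (_ ∣_) (ℤ.neg-involutive a) (∣m⇒∣-m p)) ∣m⇒∣-m

  τ-normalises : ∀ N v → ¬ + 3 ∣ N + + 2 → uncurry₃ Q v ≡ + 4 * (+ 8 * N + + 29) → ¬ + 2 ∣ proj₁ v →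
    ∃ λ q → τ v ·ᴮ v ≡ pᴮ q
  τ-normalises N (U , V , W) 3∤N+2 Q≡4m 2∤U = ∈-image-pᴮ N U _ _
    (trans (Q-·ᴮ (τ (U , V , W)) (U , V , W)) Q≡4m)
    (Equivalence.from (∣-negateUnless (does (+ 3 ∣? U + V))) 2∣V)
    (2∤W ∘ Equivalence.to (∣-negateUnless (does (+ 4 ∣? U - W)))) 4-normal 3-normal
    where
    parities : + 2 ∣ V × ¬ + 2 ∣ W
    parities = proj₁ (4∣Q⇒parities U V W (divides (+ 8 * N + + 29) (trans Q≡4m (ℤ.*-comm (+ 4) _)))) 2∤U
    2∣V : + 2 ∣ V
    2∣V = proj₁ parities
    2∤W : ¬ + 2 ∣ W
    2∤W = proj₂ parities
    4-normal : + 4 ∣ U - negateUnless (does (+ 4 ∣? U - W)) W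
    4-normal = does-elim (+ 4 ∣? U - W) (λ b → + 4 ∣ U - negateUnless b W) (λ 4∣U-W → 4∣U-W)
      λ 4∤U-W → subst (λ w → + 4 ∣ U + w) (sym (ℤ.neg-involutive W))
        (fromInj₂ (λ 4∣U-W → contradiction 4∣U-W 4∤U-W) (4∣U-W⊎4∣U+W U W 2∤U 2∤W))
    3-normal : + 3 ∣ U + negateUnless (does (+ 3 ∣? U + V)) V
    3-normal = does-elim (+ 3 ∣? U + V) (λ b → + 3 ∣ U + negateUnless b V) (λ 3∣U+V → 3∣U+V)
      λ 3∤U+V → fromInj₂ (λ 3∣U+V → contradiction 3∣U+V 3∤U+V) (3∣U+V⊎3∣U-V N U V W 3∤N+2 Q≡4m)

  τ-σ : ∀ h q → τ (h ·ᴮ pᴮ q) ≡ σ (h ·ᴬ pᴬ q)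
  τ-σ h q = sym (σ-τ h q)

  -- B↔A.φ is A↔B.ψ and B↔A.ψ is A↔B.φ, so B↔A.ψ∘φ is the second inverse law.
  module A↔B = Twisted _·ᴬ_ _·ᴮ_ ·ᴬ-involutive ·ᴮ-involutive σ τ F G pᴬ pᴮ F∘pᴬ G∘pᴮ σ-τ
  module B↔A = Twisted _·ᴮ_ _·ᴬ_ ·ᴮ-involutive ·ᴬ-involutive τ σ G F pᴮ pᴬ G∘pᴮ F∘pᴬ τ-σ

  -- Counting

  swap : ℤ³ → ℤ³
  swap (U , V , W) = V , U , W

  double : ℤ³ → ℤ³
  double (x , y , z) = x * + 2 , y * + 2 , z * + 2

  halve : ℤ³ → ℤ³
  halve (U , V , W) = U /ℕ 2 , V /ℕ 2 , W /ℕ 2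

  Q-swap : ∀ v → uncurry₃ Q (swap v) ≡ uncurry₃ Q v
  Q-swap (U , V , W) = commute (U * U) (V * V) (+ 27 * (W * W))
    where commute : ∀ a b c → b + a + c ≡ a + b + c
          commute = solve-∀

  Q-double : ∀ v → uncurry₃ Q (double v) ≡ + 4 * uncurry₃ Q v
  Q-double (x , y , z) = expand x y z
    where expand : ∀ x y z → (x * + 2) * (x * + 2) + (y * + 2) * (y * + 2) + + 27 * ((z * + 2) * (z * + 2)) ≡ + 4 * (x * x + y * y + + 27 * (z * z))
          expand = solve-∀

  halve-double : ∀ v → halve (double v) ≡ v
  halve-double (x , y , z) = cong₂ _,_ (/ℕ-exact 2 x) (cong₂ _,_ (/ℕ-exact 2 y) (/ℕ-exact 2 z))

  double-halve : ∀ {v} → + 2 ∣ proj₁ v × + 2 ∣ proj₁ (proj₂ v) × + 2 ∣ proj₂ (proj₂ v) → double (halve v) ≡ v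
  double-halve (divides u refl , divides v refl , divides w refl) =
    cong₂ _,_ (cong (_* + 2) (/ℕ-exact 2 u)) (cong₂ _,_ (cong (_* + 2) (/ℕ-exact 2 v)) (cong (_* + 2) (/ℕ-exact 2 w)))

  module SolutionLists (n : ℕ) (n%3≢1 : n ℕ.% 3 ≢ 1) where

    N : ℤ
    N = + n
    3∤N+2 : ¬ + 3 ∣ N + + 2
    3∤N+2 = n%3≢1⇒3∤n+2 n n%3≢1
    m : ℕ
    m = 8 ℕ.* n ℕ.+ 29

    Lt Lm L4m : List ℤ³
    Lt = solutions (suc n) T (+ (2 ℕ.* n))
    Lm = solutions m Q (+ m)
    L4m = solutions (4 ℕ.* m) Q (+ (4 ℕ.* m))

    even₁? : Decidable (λ (v : ℤ³) → + 2 ∣ proj₁ v)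
    even₁? v = + 2 ∣? proj₁ v

    even₂? : Decidable (λ (v : ℤ³) → + 2 ∣ proj₁ (proj₂ v))
    even₂? v = + 2 ∣? proj₁ (proj₂ v)

    -- The subscripts are the parities of U and V (1 odd, 0 even).
    L4m₁ L4m₀ L4m₀₁ L4m₀₀ : List ℤ³
    L4m₁ = filter (∁? even₁?) L4m
    L4m₀ = filter even₁? L4m
    L4m₀₁ = filter (∁? even₂?) L4m₀
    L4m₀₀ = filter even₂? L4m₀

    open ≡-Reasoning

    4m≡ : + (4 ℕ.* m) ≡ + 4 * (+ 8 * N + + 29)
    4m≡ = trans (ℤ.pos-* 4 m) (cong (+ 4 *_) (trans (ℤ.pos-+ (8 ℕ.* n) 29) (cong (_+ + 29) (ℤ.pos-* 8 n))))

    4m≡16[2N]+116 : + 4 * (+ 8 * N + + 29) ≡ + 16 * (+ 2 * N) + + 116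
    4m≡16[2N]+116 = expand N
      where expand : ∀ N → + 4 * (+ 8 * N + + 29) ≡ + 16 * (+ 2 * N) + + 116
            expand = solve-∀

    ∈Lt⁻ : ∀ {v} → v ∈ Lt → uncurry₃ T v ≡ + 2 * N
    ∈Lt⁻ v∈ = trans (∈-solutions⁻ {suc n} {T} v∈) (ℤ.pos-* 2 n)

    ∈Lt⁺ : ∀ v → uncurry₃ T v ≡ + 2 * N → v ∈ Lt
    ∈Lt⁺ v Tv≡ = ∈-solutions⁺ {suc n} {T} v (T-inBox v Tv≡′) Tv≡′
      where Tv≡′ = trans Tv≡ (sym (ℤ.pos-* 2 n))

    ∈L4m⁻ : ∀ {v} → v ∈ L4m → uncurry₃ Q v ≡ + 4 * (+ 8 * N + + 29)
    ∈L4m⁻ v∈ = trans (∈-solutions⁻ {4 ℕ.* m} {Q} v∈) 4m≡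

    ∈L4m⁺ : ∀ v → uncurry₃ Q v ≡ + 4 * (+ 8 * N + + 29) → v ∈ L4m
    ∈L4m⁺ v Qv≡ = ∈-solutions⁺ {4 ℕ.* m} {Q} v (Q-inBox v Qv≡′) Qv≡′
      where Qv≡′ = trans Qv≡ (sym 4m≡)

    ∈Lm⁻ : ∀ {v} → v ∈ Lm → uncurry₃ Q v ≡ + m
    ∈Lm⁻ = ∈-solutions⁻ {m} {Q}

    ∈Lm⁺ : ∀ v → uncurry₃ Q v ≡ + m → v ∈ Lm
    ∈Lm⁺ v Qv≡m = ∈-solutions⁺ {m} {Q} v (Q-inBox v Qv≡m) Qv≡m

    ∈L4m₁⁻ : ∀ {v} → v ∈ L4m₁ → v ∈ L4m × ¬ + 2 ∣ proj₁ v
    ∈L4m₁⁻ = ∈-filter⁻ (∁? even₁?) {xs = L4m}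

    ∈L4m₀⁻ : ∀ {v} → v ∈ L4m₀ → v ∈ L4m × + 2 ∣ proj₁ v
    ∈L4m₀⁻ = ∈-filter⁻ even₁? {xs = L4m}

    ∈L4m₀₁⁻ : ∀ {v} → v ∈ L4m₀₁ → v ∈ L4m₀ × ¬ + 2 ∣ proj₁ (proj₂ v)
    ∈L4m₀₁⁻ = ∈-filter⁻ (∁? even₂?) {xs = L4m₀}

    ∈L4m₀₀⁻ : ∀ {v} → v ∈ L4m₀₀ → v ∈ L4m₀ × + 2 ∣ proj₁ (proj₂ v)
    ∈L4m₀₀⁻ = ∈-filter⁻ even₂? {xs = L4m₀}

    parities : ∀ {v} → v ∈ L4m → (¬ + 2 ∣ proj₁ v → + 2 ∣ proj₁ (proj₂ v) × ¬ + 2 ∣ proj₂ (proj₂ v)) ×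
      (+ 2 ∣ proj₁ v → + 2 ∣ proj₁ (proj₂ v) → + 2 ∣ proj₂ (proj₂ v))
    parities {U , V , W} v∈ = 4∣Q⇒parities U V W (divides (+ 8 * N + + 29) (trans (∈L4m⁻ v∈) (ℤ.*-comm (+ 4) _)))

    pᴮ-odd : ∀ q → ¬ + 2 ∣ proj₁ (pᴮ q)
    pᴮ-odd (k , j , z) = subst (λ e → ¬ + 2 ∣ e) (sym (shape k j z)) (∤-offset (j + + 3 * k + + 4 * z - + 3) (from-no (+ 2 ∣? 1ℤ)))
      where shape : ∀ k j z → + 2 * j + + 6 * k + + 8 * z - + 5 ≡ (j + + 3 * k + + 4 * z - + 3) * + 2 + 1ℤ
            shape = solve-∀

    cancel-16 : ∀ {a b} → + 16 * a + + 116 ≡ + 16 * b + + 116 → a ≡ b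
    cancel-16 {a} {b} eq = ℤ.i-j≡0⇒i≡j a b (ℤ.*-cancelˡ-≡ (+ 16) (a - b) 0ℤ (trans (sym (expand a b)) (ℤ.i≡j⇒i-j≡0 eq)))
      where expand : ∀ a b → + 16 * a + + 116 - (+ 16 * b + + 116) ≡ + 16 * (a - b)
            expand = solve-∀

    φ-maps : ∀ {v} → v ∈ Lt → A↔B.φ v ∈ L4m₁
    φ-maps {v} v∈ = from-normal (σ-normalises N v 3∤N+2 (∈Lt⁻ v∈))
      where
      from-normal : (∃ λ q → σ v ·ᴬ v ≡ pᴬ q) → A↔B.φ v ∈ L4m₁
      from-normal (q , σv·v≡pq) = ∈-filter⁺ (∁? even₁?) (∈L4m⁺ (A↔B.φ v) Qφv≡)
        (subst (λ w → ¬ + 2 ∣ proj₁ w) (sym φv≡) (pᴮ-odd q))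
        where
        φv≡ : A↔B.φ v ≡ σ v ·ᴮ pᴮ q
        φv≡ = A↔B.φ-normal {v} {q} σv·v≡pq
        Qφv≡ : uncurry₃ Q (A↔B.φ v) ≡ + 4 * (+ 8 * N + + 29)
        Qφv≡ = begin
          uncurry₃ Q (A↔B.φ v)                  ≡⟨ cong (uncurry₃ Q) φv≡ ⟩
          uncurry₃ Q (σ v ·ᴮ pᴮ q)              ≡⟨ Q-·ᴮ (σ v) (pᴮ q) ⟩
          uncurry₃ Q (pᴮ q)                     ≡⟨ Q∘pᴮ q ⟩
          + 16 * uncurry₃ T (pᴬ q) + + 116      ≡⟨ cong (λ s → + 16 * uncurry₃ T s + + 116) σv·v≡pq ⟨
          + 16 * uncurry₃ T (σ v ·ᴬ v) + + 116  ≡⟨ cong (λ s → + 16 * s + + 116) (trans (T-·ᴬ (σ v) v) (∈Lt⁻ v∈)) ⟩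
          + 16 * (+ 2 * N) + + 116              ≡⟨ 4m≡16[2N]+116 ⟨
          + 4 * (+ 8 * N + + 29)                ∎

    ψ-maps : ∀ {w} → w ∈ L4m₁ → A↔B.ψ w ∈ Lt
    ψ-maps {w} w∈ = from-normal (τ-normalises N w 3∤N+2 (∈L4m⁻ w∈L4m) (proj₂ (∈L4m₁⁻ w∈)))
      where
      w∈L4m : w ∈ L4m
      w∈L4m = proj₁ (∈L4m₁⁻ w∈)
      from-normal : (∃ λ q → τ w ·ᴮ w ≡ pᴮ q) → A↔B.ψ w ∈ Lt
      from-normal (q , τw·w≡pq) = ∈Lt⁺ (A↔B.ψ w)
        (trans (cong (uncurry₃ T) (B↔A.φ-normal {w} {q} τw·w≡pq)) (trans (T-·ᴬ (τ w) (pᴬ q)) (cancel-16 (begin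
          + 16 * uncurry₃ T (pᴬ q) + + 116    ≡⟨ Q∘pᴮ q ⟨
          uncurry₃ Q (pᴮ q)                   ≡⟨ cong (uncurry₃ Q) τw·w≡pq ⟨
          uncurry₃ Q (τ w ·ᴮ w)               ≡⟨ Q-·ᴮ (τ w) w ⟩
          uncurry₃ Q w                        ≡⟨ ∈L4m⁻ w∈L4m ⟩
          + 4 * (+ 8 * N + + 29)              ≡⟨ 4m≡16[2N]+116 ⟩
          + 16 * (+ 2 * N) + + 116            ∎))))

    ψ∘φ : ∀ {v} → v ∈ Lt → A↔B.ψ (A↔B.φ v) ≡ v
    ψ∘φ {v} v∈ = A↔B.ψ∘φ (σ-normalises N v 3∤N+2 (∈Lt⁻ v∈))

    φ∘ψ : ∀ {w} → w ∈ L4m₁ → A↔B.φ (A↔B.ψ w) ≡ w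
    φ∘ψ {w} w∈ = B↔A.ψ∘φ (τ-normalises N w 3∤N+2 (∈L4m⁻ (proj₁ (∈L4m₁⁻ w∈))) (proj₂ (∈L4m₁⁻ w∈)))

    all-even : ∀ {v} → v ∈ L4m₀₀ → + 2 ∣ proj₁ v × + 2 ∣ proj₁ (proj₂ v) × + 2 ∣ proj₂ (proj₂ v)
    all-even {v} v∈ = 2∣U , 2∣V , proj₂ (parities v∈L4m) 2∣U 2∣V
      where
      v∈L4m₀ : v ∈ L4m₀
      v∈L4m₀ = proj₁ (∈L4m₀₀⁻ v∈)
      2∣V : + 2 ∣ proj₁ (proj₂ v)
      2∣V = proj₂ (∈L4m₀₀⁻ v∈)
      v∈L4m : v ∈ L4m
      v∈L4m = proj₁ (∈L4m₀⁻ v∈L4m₀)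
      2∣U : + 2 ∣ proj₁ v
      2∣U = proj₂ (∈L4m₀⁻ v∈L4m₀)

    swap-maps₁ : ∀ {v} → v ∈ L4m₁ → swap v ∈ L4m₀₁
    swap-maps₁ {v} v∈ = ∈-filter⁺ (∁? even₂?)
      (∈-filter⁺ even₁? (∈L4m⁺ (swap v) (trans (Q-swap v) (∈L4m⁻ v∈L4m))) (proj₁ (proj₁ (parities v∈L4m) 2∤U))) 2∤U
      where
      v∈L4m : v ∈ L4m
      v∈L4m = proj₁ (∈L4m₁⁻ v∈)
      2∤U : ¬ + 2 ∣ proj₁ v
      2∤U = proj₂ (∈L4m₁⁻ v∈)

    swap-maps₀₁ : ∀ {v} → v ∈ L4m₀₁ → swap v ∈ L4m₁
    swap-maps₀₁ {v} v∈ = ∈-filter⁺ (∁? even₁?) (∈L4m⁺ (swap v) (trans (Q-swap v) (∈L4m⁻ v∈L4m))) 2∤V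
      where
      v∈L4m : v ∈ L4m
      v∈L4m = proj₁ (∈L4m₀⁻ (proj₁ (∈L4m₀₁⁻ v∈)))
      2∤V : ¬ + 2 ∣ proj₁ (proj₂ v)
      2∤V = proj₂ (∈L4m₀₁⁻ v∈)

    double-maps : ∀ {v} → v ∈ Lm → double v ∈ L4m₀₀
    double-maps {x , y , z} v∈ = ∈-filter⁺ even₂? (∈-filter⁺ even₁? (∈L4m⁺ _ Q≡) (divides x refl)) (divides y refl)
      where
      Q≡ : uncurry₃ Q (double (x , y , z)) ≡ + 4 * (+ 8 * N + + 29)
      Q≡ = trans (Q-double (x , y , z)) (trans (cong (+ 4 *_) (∈Lm⁻ v∈)) (trans (sym (ℤ.pos-* 4 m)) 4m≡))

    double∘halve : ∀ {v} → v ∈ L4m₀₀ → double (halve v) ≡ v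
    double∘halve v∈ = double-halve (all-even v∈)

    halve-maps : ∀ {v} → v ∈ L4m₀₀ → halve v ∈ Lm
    halve-maps {v} v∈ = ∈Lm⁺ (halve v) (ℤ.*-cancelˡ-≡ (+ 4) _ _ (begin
      + 4 * uncurry₃ Q (halve v)       ≡⟨ Q-double (halve v) ⟨
      uncurry₃ Q (double (halve v))    ≡⟨ cong (uncurry₃ Q) (double∘halve v∈) ⟩
      uncurry₃ Q v                     ≡⟨ ∈L4m⁻ (proj₁ (∈L4m₀⁻ (proj₁ (∈L4m₀₀⁻ v∈)))) ⟩
      + 4 * (+ 8 * N + + 29)           ≡⟨ trans (sym 4m≡) (ℤ.pos-* 4 m) ⟩
      + 4 * + m                        ∎))

    |L4m|≡|Lm|+2|Lt| : length L4m ≡ length Lm ℕ.+ length Lt ℕ.+ length Lt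
    |L4m|≡|Lm|+2|Lt| = begin
      length L4m                                   ≡⟨ length-filter-∁ even₁? L4m ⟩
      length L4m₀ ℕ.+ length L4m₁                   ≡⟨ cong (ℕ._+ length L4m₁) (length-filter-∁ even₂? L4m₀) ⟩
      length L4m₀₀ ℕ.+ length L4m₀₁ ℕ.+ length L4m₁  ≡⟨ cong₂ (λ a b → a ℕ.+ b ℕ.+ length L4m₁) |L4m₀₀|≡|Lm| |L4m₀₁|≡|Lt| ⟩
      length Lm ℕ.+ length Lt ℕ.+ length L4m₁      ≡⟨ cong (length Lm ℕ.+ length Lt ℕ.+_) |L4m₁|≡|Lt| ⟩
      length Lm ℕ.+ length Lt ℕ.+ length Lt       ∎
      where
      |L4m₁|≡|Lt| : length L4m₁ ≡ length Lt
      |L4m₁|≡|Lt| = length-≡-bijection L4m₁ Lt A↔B.ψ A↔B.φ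
        (Unique.filter⁺ _ (solutions-unique _ Q _)) (solutions-unique _ T _) ψ-maps φ-maps φ∘ψ ψ∘φ
      |L4m₀₁|≡|Lt| : length L4m₀₁ ≡ length Lt
      |L4m₀₁|≡|Lt| = trans (length-≡-bijection L4m₀₁ L4m₁ swap swap
        (Unique.filter⁺ _ (Unique.filter⁺ _ (solutions-unique _ Q _)))
        (Unique.filter⁺ _ (solutions-unique _ Q _)) swap-maps₀₁ swap-maps₁ (λ _ → refl) (λ _ → refl)) |L4m₁|≡|Lt|
      |L4m₀₀|≡|Lm| : length L4m₀₀ ≡ length Lm
      |L4m₀₀|≡|Lm| = length-≡-bijection L4m₀₀ Lm halve double
        (Unique.filter⁺ _ (Unique.filter⁺ _ (solutions-unique _ Q _))) (solutions-unique _ Q _)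
        halve-maps double-maps double∘halve (λ {v} _ → halve-double v)

    t≡|Lt| : t 1 1 27 n ≡ length Lt
    t≡|Lt| = countIn≡length-solutions (suc n) _ T _ λ x y z →
      cong₂ (λ a b → a + b + + 27 * tri2 z) (ℤ.*-identityˡ (tri2 x)) (ℤ.*-identityˡ (tri2 y))

    r≡|solutions| : ∀ M → r-x²+y²+27z² M ≡ length (solutions M Q (+ M))
    r≡|solutions| M = countIn≡length-solutions M _ Q _ λ _ _ _ → refl

  twice≡sum-difference : ∀ a c → + 2 * + a ≡ + (c ℕ.+ a ℕ.+ a) - + c
  twice≡sum-difference a c = begin
    + 2 * + a                     ≡⟨ regroup (+ a) (+ c) ⟩
    + c + + a + + a - + c         ≡⟨ cong (_- + c) (trans (cong (_+ + a) (ℤ.pos-+ c a)) (ℤ.pos-+ (c ℕ.+ a) a)) ⟨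
    + (c ℕ.+ a ℕ.+ a) - + c       ∎
    where
    open ≡-Reasoning
    regroup : ∀ a c → + 2 * a ≡ c + a + a - c
    regroup = solve-∀

open import Data.Nat using (ℕ; _+_; _*_; _%_; _≤_)
open import Data.Integer using (+_) renaming (_*_ to _*ℤ_; _-_ to _-ℤ_)
open import Relation.Binary.PropositionalEquality using (_≡_; _≢_; cong; cong₂; module ≡-Reasoning)
open import Data.List using (length)

theorem3p8 : (n : ℕ) → 1 ≤ n → n % 3 ≢ 1 →
    (+ 2) *ℤ (+ t 1 1 27 n)
    ≡ (+ r-x²+y²+27z² (4 * (8 * n + 29))) -ℤ (+ r-x²+y²+27z² (8 * n + 29))
theorem3p8 n _ n%3≢1 = begin
  + 2 *ℤ + t 1 1 27 n                                    ≡⟨ cong (λ a → + 2 *ℤ + a) t≡|Lt| ⟩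
  + 2 *ℤ + length Lt                                     ≡⟨ twice≡sum-difference (length Lt) (length Lm) ⟩
  + (length Lm + length Lt + length Lt) -ℤ + length Lm   ≡⟨ cong (λ a → + a -ℤ + length Lm) |L4m|≡|Lm|+2|Lt| ⟨
  + length L4m -ℤ + length Lm                            ≡⟨ cong₂ (λ a b → + a -ℤ + b) (r≡|solutions| _) (r≡|solutions| _) ⟨
  + r-x²+y²+27z² (4 * (8 * n + 29)) -ℤ + r-x²+y²+27z² (8 * n + 29) ∎
  where
  open SolutionLists n n%3≢1
  open ≡-Reasoning
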